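{- For all $n \in \mathbb{N}$, $H(n) \leq \sum_{k=1}^n \frac{n}{k}$.
   Context: A hypergraph is a set $V$ with a family $\mathcal{H}$ of subsets of $V$; a vertex is isolated if it lies in no hyperedge. $(V,\mathcal{H})$ contains a partition of size $m$ if there are $D\subseteq V$, $\mathcal{P}\subseteq\mathcal{H}$ with $|D|=m$ and every member of $D$ in exactly one member of $\mathcal{P}$. $H(n)$ is the greatest $k$ such that there is a hypergraph with $|V|=k$, no isolated vertices, and no partition of size greater than $n$. -}

module Defs where

open import Data.Nat using (ℕ; zero; suc; _≤_)
open import Data.Fin using (Fin)
open import Data.Fin.Subset using (Subset; _∈_; _∩_; ∣_∣)
open import Data.Vec using (lookup; tabulate)
open import Data.Integer using (+_)
open import Data.Product using (Σ; ∃; _×_)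
open import Data.Rational using (ℚ; 0ℚ; _+_; _/_)
open import Relation.Binary.PropositionalEquality using (_≡_)

record Hypergraph (k : ℕ) : Set where
  field
    e    : ℕ
    edge : Fin e → Subset k
open Hypergraph public

NoIsolated : ∀ {k} → Hypergraph k → Set
NoIsolated {k} G = (v : Fin k) → ∃ λ (i : Fin (e G)) → v ∈ edge G i

edgesAt : ∀ {k} (G : Hypergraph k) → Subset (e G) → Fin k → Subset (e G)
edgesAt G P v = P ∩ tabulate (λ i → lookup (edge G i) v)

-- G contains a partition of size m: a set D of m vertices and a
-- subfamily P of hyperedges such that every vertex of D lies in exactly
-- one member of P
HasPartition : ∀ {k} → Hypergraph k → ℕ → Set
HasPartition {k} G m =
  Σ (Subset k) λ D → Σ (Subset (e G)) λ P →
    (∣ D ∣ ≡ m) × ((v : Fin k) → v ∈ D → ∣ edgesAt G P v ∣ ≡ 1)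

NoPartitionAbove : ∀ {k} → Hypergraph k → ℕ → Set
NoPartitionAbove G n = (m : ℕ) → HasPartition G m → m ≤ n

harmonicSum : ℕ → ℕ → ℚ
harmonicSum n zero    = 0ℚ
harmonicSum n (suc j) = harmonicSum n j + (+ n) / suc j

bound : ℕ → ℚ
bound n = harmonicSum n n

module Submission where

-- Greedy peeling. Let a family T of t edges cover a vertex set S, and call a vertex uniquely
-- covered when it lies in exactly one edge of T. The uniquely covered vertices together with T
-- form a partition, so there are at most n of them, and hence some edge of T holds at most n/t
-- of them (its private vertices). Deleting that edge and its private vertices leaves t - 1 edges
-- covering the rest of S, so |S| ≤ Σ_{j ≤ t} ⌊n/j⌋; the terms vanish for j > n, which bounds
-- |S| by Σ_{j=1}^{n} n/j.

open import Defs
open import Data.Nat using (ℕ)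

module Counting where

  open import Data.Nat hiding (_≟_)
  open import Data.Nat.Properties hiding (_≟_)
  open import Algebra.Properties.CommutativeSemigroup +-commutativeSemigroup using (x∙yz≈y∙xz)
  open import Algebra.Properties.Semiring.Sum +-*-semiring
    using (sum; sum-cong-≗; sum-replicate-zero; ∑-distrib-+; ∑-comm; *-distribˡ-sum; *-distribʳ-sum)
  open import Data.Bool using (Bool; true; false; not; _∧_)
  open import Data.Fin using (Fin; zero; suc; _≟_)
  open import Data.Fin.Subset using (_∈_; _∩_; ∣_∣)
  open import Data.Product using (∃; _×_; _,_)
  open import Data.Sum using (_⊎_; inj₁; inj₂)
  open import Data.Vec using (_∷_; tabulate)
  open import Data.Vec.Properties using (lookup∘tabulate; []=⇒lookup)
  open import Function using (_∘_)
  open import Relation.Nullary using (does; yes; no; contradiction)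
  open import Relation.Binary.PropositionalEquality

  indicator : Bool → ℕ
  indicator true  = 1
  indicator false = 0

  indicator-∧ : ∀ a b → indicator (a ∧ b) ≡ indicator a * indicator b
  indicator-∧ true  b = sym (+-identityʳ (indicator b))
  indicator-∧ false b = refl

  count : ∀ {m} → (Fin m → Bool) → ℕ
  count P = sum (indicator ∘ P)

  sum-mono-≤ : ∀ {m} {f g : Fin m → ℕ} → (∀ i → f i ≤ g i) → sum f ≤ sum g
  sum-mono-≤ {zero}  f≤g = z≤n
  sum-mono-≤ {suc m} f≤g = +-mono-≤ (f≤g zero) (sum-mono-≤ (f≤g ∘ suc))

  count-true : ∀ m → count {m} (λ _ → true) ≡ m
  count-true zero    = refl
  count-true (suc m) = cong suc (count-true m)

  count-false : ∀ {m} {P : Fin m → Bool} → (∀ i → P i ≡ false) → count P ≡ 0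
  count-false {m} P≡false = trans (sum-cong-≗ (cong indicator ∘ P≡false)) (sum-replicate-zero m)

  count-∧-≤ : ∀ {m} (P Q : Fin m → Bool) → count (λ i → P i ∧ Q i) ≤ count P
  count-∧-≤ P Q = sum-mono-≤ (λ i → indicator-∧-≤ (P i) (Q i))
    where
    indicator-∧-≤ : ∀ a b → indicator (a ∧ b) ≤ indicator a
    indicator-∧-≤ true  true  = ≤-refl
    indicator-∧-≤ true  false = z≤n
    indicator-∧-≤ false b     = ≤-refl

  count-≤-count-∧-not+count : ∀ {m} (P Q : Fin m → Bool) →
                        count P ≤ count (λ i → P i ∧ not (Q i)) + count Q
  count-≤-count-∧-not+count P Q =
    ≤-trans (sum-mono-≤ (λ i → split (P i) (Q i))) (≤-reflexive (∑-distrib-+ (λ i → indicator (P i ∧ not (Q i))) (indicator ∘ Q)))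
    where
    split : ∀ a b → indicator a ≤ indicator (a ∧ not b) + indicator b
    split true  true  = ≤-refl
    split true  false = ≤-refl
    split false b     = z≤n

  remove : ∀ {m} → Fin m → (Fin m → Bool) → Fin m → Bool
  remove i P j = not (does (i ≟ j)) ∧ P j

  count-remove : ∀ {m} (P : Fin m → Bool) i → count P ≡ indicator (P i) + count (remove i P)
  count-remove P zero    = refl
  count-remove P (suc i) =
    trans (cong (indicator (P zero) +_) (count-remove (P ∘ suc) i)) (x∙yz≈y∙xz (indicator (P zero)) (indicator (P (suc i))) _)

  count-remove-true : ∀ {m} (P : Fin m → Bool) {i} → P i ≡ true → count P ≡ suc (count (remove i P))
  count-remove-true P {i} Pi = trans (count-remove P i) (cong (λ b → indicator b + count (remove i P)) Pi)

  count-pos : ∀ {m} (P : Fin m → Bool) {i} → P i ≡ true → 0 < count P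
  count-pos P Pi rewrite count-remove-true P Pi = s≤s z≤n

  ∣tabulate∣≡count : ∀ {m} (P : Fin m → Bool) → ∣ tabulate P ∣ ≡ count P
  ∣tabulate∣≡count {zero}  P = refl
  ∣tabulate∣≡count {suc m} P with P zero
  ... | true  = cong suc (∣tabulate∣≡count (P ∘ suc))
  ... | false = ∣tabulate∣≡count (P ∘ suc)

  tabulate-∩ : ∀ {m} (P Q : Fin m → Bool) → tabulate P ∩ tabulate Q ≡ tabulate (λ i → P i ∧ Q i)
  tabulate-∩ {zero}  P Q = refl
  tabulate-∩ {suc m} P Q = cong (P zero ∧ Q zero ∷_) (tabulate-∩ (P ∘ suc) (Q ∘ suc))

  ∈-tabulate⁻ : ∀ {m} (P : Fin m → Bool) {i} → i ∈ tabulate P → P i ≡ true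
  ∈-tabulate⁻ P {i} i∈P = trans (sym (lookup∘tabulate P i)) ([]=⇒lookup i∈P)

  Minimiser : ∀ {m} → (Fin m → Bool) → (Fin m → ℕ) → Set
  Minimiser P f = ∃ λ i → P i ≡ true × (∀ j → P j ≡ true → f i ≤ f j)

  minimiser? : ∀ {m} (P : Fin m → Bool) (f : Fin m → ℕ) → (∀ i → P i ≡ false) ⊎ Minimiser P f
  minimiser? {zero}  P f = inj₁ λ ()
  minimiser? {suc m} P f with P zero in P₀ | minimiser? (P ∘ suc) (f ∘ suc)
  ... | false | inj₁ none = inj₁ λ { zero → P₀ ; (suc i) → none i }
  ... | false | inj₂ (i , Pi , minimal) =
    inj₂ (suc i , Pi , λ { zero P₀′ → contradiction (trans (sym P₀) P₀′) λ () ; (suc j) → minimal j })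
  ... | true  | inj₁ none =
    inj₂ (zero , P₀ , λ { zero _ → ≤-refl ; (suc j) Pj → contradiction (trans (sym (none j)) Pj) λ () })
  ... | true  | inj₂ (i , Pi , minimal) with f zero ≤? f (suc i)
  ...   | yes f₀≤ = inj₂ (zero , P₀ , λ { zero _ → ≤-refl ; (suc j) Pj → ≤-trans f₀≤ (minimal j Pj) })
  ...   | no  f₀≰ = inj₂ (suc i , Pi , λ { zero _ → <⇒≤ (≰⇒> f₀≰) ; (suc j) Pj → minimal j Pj })

  count-*-≤-sum : ∀ {m} (P : Fin m → Bool) (f : Fin m → ℕ) {i} →
                  (∀ j → P j ≡ true → f i ≤ f j) → count P * f i ≤ sum f
  count-*-≤-sum P f {i} minimal = begin
    count P * f i                     ≡⟨ *-distribʳ-sum (f i) (indicator ∘ P) ⟩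
    sum (λ j → indicator (P j) * f i) ≤⟨ sum-mono-≤ term-≤ ⟩
    sum f                             ∎
    where
    open ≤-Reasoning
    term-≤ : ∀ j → indicator (P j) * f i ≤ f j
    term-≤ j with P j in Pj
    ... | true  = ≤-trans (≤-reflexive (+-identityʳ (f i))) (minimal j Pj)
    ... | false = z≤n

  sum-count-∧ : ∀ {m l} (A : Fin l → Bool) (B : Fin m → Fin l → Bool) →
                sum (λ i → count (λ v → A v ∧ B i v)) ≡ sum (λ v → indicator (A v) * count (λ i → B i v))
  sum-count-∧ A B = begin
    sum (λ i → count (λ v → A v ∧ B i v))
      ≡⟨ sum-cong-≗ (λ i → sum-cong-≗ (λ v → indicator-∧ (A v) (B i v))) ⟩
    sum (λ i → sum (λ v → indicator (A v) * indicator (B i v)))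
      ≡⟨ ∑-comm (λ i v → indicator (A v) * indicator (B i v)) ⟩
    sum (λ v → sum (λ i → indicator (A v) * indicator (B i v)))
      ≡⟨ sum-cong-≗ (λ v → sym (*-distribˡ-sum (indicator (A v)) (λ i → indicator (B i v)))) ⟩
    sum (λ v → indicator (A v) * count (λ i → B i v)) ∎
    where open ≡-Reasoning

module FloorHarmonic where

  open import Data.Nat
  open import Data.Nat.DivMod using (m*n/n≡m; /-monoˡ-≤; m<n⇒m/n≡0)
  open import Data.Nat.Properties
  open import Data.Sum using (inj₁; inj₂)
  open import Relation.Binary.PropositionalEquality

  floorHarmonic : ℕ → ℕ → ℕ
  floorHarmonic n zero    = 0
  floorHarmonic n (suc j) = floorHarmonic n j + n / suc j

  m*n≤o⇒n≤o/m : ∀ {m n o} .{{_ : NonZero m}} → m * n ≤ o → n ≤ o / m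
  m*n≤o⇒n≤o/m {m} {n} {o} m*n≤o = begin
    n         ≡⟨ m*n/n≡m n m ⟨
    n * m / m ≤⟨ /-monoˡ-≤ m (≤-trans (≤-reflexive (*-comm n m)) m*n≤o) ⟩
    o / m     ∎
    where open ≤-Reasoning

  floorHarmonic-mono : ∀ n {t u} → t ≤ u → floorHarmonic n t ≤ floorHarmonic n u
  floorHarmonic-mono n {u = zero}  z≤n   = ≤-refl
  floorHarmonic-mono n {u = suc u} t≤1+u with m≤n⇒m<n∨m≡n t≤1+u
  ... | inj₁ (s≤s t≤u) = ≤-trans (floorHarmonic-mono n t≤u) (m≤m+n _ _)
  ... | inj₂ refl      = ≤-refl

  floorHarmonic-stable : ∀ n {t} → n ≤ t → floorHarmonic n t ≡ floorHarmonic n n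
  floorHarmonic-stable n {zero}  z≤n   = refl
  floorHarmonic-stable n {suc t} n≤1+t with m≤n⇒m<n∨m≡n n≤1+t
  ... | inj₂ refl      = refl
  ... | inj₁ (s≤s n≤t) = begin
    floorHarmonic n t + n / suc t ≡⟨ cong (floorHarmonic n t +_) (m<n⇒m/n≡0 (s≤s n≤t)) ⟩
    floorHarmonic n t + 0         ≡⟨ +-identityʳ _ ⟩
    floorHarmonic n t             ≡⟨ floorHarmonic-stable n n≤t ⟩
    floorHarmonic n n             ∎
    where open ≡-Reasoning

  floorHarmonic-≤-diagonal : ∀ n t → floorHarmonic n t ≤ floorHarmonic n n
  floorHarmonic-≤-diagonal n t with ≤-total t n
  ... | inj₁ t≤n = floorHarmonic-mono n t≤n
  ... | inj₂ n≤t = ≤-reflexive (floorHarmonic-stable n n≤t)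

module Covering {k} (G : Hypergraph k) where

  open Counting
  open FloorHarmonic
  open import Data.Nat
  open import Data.Nat.Properties
  open import Algebra.Properties.Semiring.Sum +-*-semiring using (sum; sum-cong-≗)
  open import Data.Bool using (Bool; true; false; not; _∧_)
  open import Data.Bool.Properties using (∧-assoc; T-≡)
  open import Data.Empty using (⊥-elim)
  open import Data.Fin using (Fin)
  open import Data.Fin.Subset using (_∈_; ∣_∣)
  open import Data.Product using (∃; _×_; _,_)
  open import Data.Sum using (inj₁; inj₂)
  open import Data.Vec using (lookup; tabulate)
  open import Data.Vec.Properties using ([]=⇒lookup)
  open import Function.Bundles using (Equivalence)
  open import Relation.Binary.PropositionalEquality

  incident : Fin (e G) → Fin k → Bool
  incident i v = lookup (edge G i) v

  degree : (Fin (e G) → Bool) → Fin k → ℕ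
  degree T v = count (λ i → T i ∧ incident i v)

  Covers : (Fin (e G) → Bool) → (Fin k → Bool) → Set
  Covers T S = ∀ v → S v ≡ true → 0 < degree T v

  uniquelyCovered : (Fin (e G) → Bool) → Fin k → Bool
  uniquelyCovered T v = degree T v ≡ᵇ 1

  isPrivate : (Fin (e G) → Bool) → Fin (e G) → Fin k → Bool
  isPrivate T i v = uniquelyCovered T v ∧ (T i ∧ incident i v)

  uniquelyCovered⇒degree≡1 : ∀ T v → uniquelyCovered T v ≡ true → degree T v ≡ 1
  uniquelyCovered⇒degree≡1 T v unique = ≡ᵇ⇒≡ (degree T v) 1 (Equivalence.from T-≡ unique)

  ∣edgesAt∣≡degree : ∀ T v → ∣ edgesAt G (tabulate T) v ∣ ≡ degree T v
  ∣edgesAt∣≡degree T v =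
    trans (cong ∣_∣ (tabulate-∩ T (λ i → incident i v))) (∣tabulate∣≡count (λ i → T i ∧ incident i v))

  count-uniquelyCovered-≤ : ∀ {n} → NoPartitionAbove G n → ∀ T → count (uniquelyCovered T) ≤ n
  count-uniquelyCovered-≤ noPartition T =
    noPartition _ (tabulate (uniquelyCovered T) , tabulate T , ∣tabulate∣≡count (uniquelyCovered T) , unique)
    where
    unique : ∀ v → v ∈ tabulate (uniquelyCovered T) → ∣ edgesAt G (tabulate T) v ∣ ≡ 1
    unique v v∈D = trans (∣edgesAt∣≡degree T v)
                         (uniquelyCovered⇒degree≡1 T v (∈-tabulate⁻ (uniquelyCovered T) v∈D))

  sum-count-isPrivate : ∀ T → sum (λ i → count (isPrivate T i)) ≡ count (uniquelyCovered T)
  sum-count-isPrivate T =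
    trans (sum-count-∧ (uniquelyCovered T) (λ i v → T i ∧ incident i v)) (sum-cong-≗ private-once)
    where
    private-once : ∀ v → indicator (uniquelyCovered T v) * degree T v ≡ indicator (uniquelyCovered T v)
    private-once v with uniquelyCovered T v in unique
    ... | true  = cong (_+ 0) (uniquelyCovered⇒degree≡1 T v unique)
    ... | false = refl

  edge-with-few-private-vertices :
    ∀ {n} → NoPartitionAbove G n → ∀ T → 0 < count T →
    ∃ λ i → T i ≡ true × count T * count (isPrivate T i) ≤ n
  edge-with-few-private-vertices {n} noPartition T 0<|T|
    with minimiser? T (λ i → count (isPrivate T i))
  ... | inj₁ none = ⊥-elim (n≮0 (subst (0 <_) (count-false none) 0<|T|))
  ... | inj₂ (i , Ti , minimal) = i , Ti , (begin
    count T * count (isPrivate T i)     ≤⟨ count-*-≤-sum T _ minimal ⟩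
    sum (λ j → count (isPrivate T j))   ≡⟨ sum-count-isPrivate T ⟩
    count (uniquelyCovered T)           ≤⟨ count-uniquelyCovered-≤ noPartition T ⟩
    n                                   ∎)
    where open ≤-Reasoning

  degree-remove : ∀ {T i} → T i ≡ true → ∀ v →
                  degree T v ≡ indicator (incident i v) + degree (remove i T) v
  degree-remove {T} {i} Ti v = begin
    degree T v
      ≡⟨ count-remove (λ j → T j ∧ incident j v) i ⟩
    indicator (T i ∧ incident i v) + count (remove i (λ j → T j ∧ incident j v))
      ≡⟨ cong₂ _+_ (cong (λ b → indicator (b ∧ incident i v)) Ti)
                   (sum-cong-≗ (λ j → cong indicator (sym (∧-assoc _ (T j) (incident j v))))) ⟩
    indicator (incident i v) + degree (remove i T) v ∎
    where open ≡-Reasoning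

  covers-remove : ∀ {T S i} → T i ≡ true → Covers T S →
                  Covers (remove i T) (λ v → S v ∧ not (isPrivate T i v))
  covers-remove {T} {S} {i} Ti covers v S′v with S v in Sv | isPrivate T i v in private?
  covers-remove Ti covers v () | false | _
  covers-remove Ti covers v () | true  | true
  covers-remove {T} {S} {i} Ti covers v _ | true | false =
    still-covered (incident i v) (covers v Sv) (degree-remove Ti v)
      (subst (λ b → uniquelyCovered T v ∧ (b ∧ incident i v) ≡ false) Ti private?)
    where
    -- if edge i held v, then v was not uniquely covered, so another edge of T still holds it
    still-covered : ∀ {d d′} b → 0 < d → d ≡ indicator b + d′ → (d ≡ᵇ 1) ∧ b ≡ false → 0 < d′
    still-covered {d′ = suc _} _     _  _    _  = s≤s z≤n
    still-covered {d′ = zero}  false () refl _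
    still-covered {d′ = zero}  true  _  refl ()

  count-covered-≤ : ∀ {n} → NoPartitionAbove G n →
                    ∀ t {T S} → count T ≡ t → Covers T S → count S ≤ floorHarmonic n t
  count-covered-≤ noPartition zero {T} {S} |T|≡0 covers = ≤-reflexive (count-false S-empty)
    where
    S-empty : ∀ v → S v ≡ false
    S-empty v with S v in Sv
    ... | false = refl
    ... | true  = ⊥-elim (n≮0 (≤-trans (covers v Sv) (≤-trans (count-∧-≤ T _) (≤-reflexive |T|≡0))))
  count-covered-≤ {n} noPartition (suc t) {T} {S} |T|≡1+t covers
    with edge-with-few-private-vertices noPartition T (subst (0 <_) (sym |T|≡1+t) z<s)
  ... | i , Ti , few = begin
    count S
      ≤⟨ count-≤-count-∧-not+count S (isPrivate T i) ⟩
    count (λ v → S v ∧ not (isPrivate T i v)) + count (isPrivate T i)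
      ≤⟨ +-mono-≤ (count-covered-≤ noPartition t |T∖i|≡t (covers-remove Ti covers))
                  (m*n≤o⇒n≤o/m (subst (λ c → c * count (isPrivate T i) ≤ n) |T|≡1+t few)) ⟩
    floorHarmonic n t + n / suc t ∎
    where
    open ≤-Reasoning
    |T∖i|≡t : count (remove i T) ≡ t
    |T∖i|≡t = suc-injective (trans (sym (count-remove-true T Ti)) |T|≡1+t)

  vertex-count-≤ : ∀ {n} → NoIsolated G → NoPartitionAbove G n → k ≤ floorHarmonic n n
  vertex-count-≤ {n} noIsolated noPartition = begin
    k                                 ≡⟨ count-true k ⟨
    count all-vertices                ≤⟨ count-covered-≤ noPartition (count all-edges) refl covers-all ⟩
    floorHarmonic n (count all-edges) ≤⟨ floorHarmonic-≤-diagonal n (count all-edges) ⟩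
    floorHarmonic n n                 ∎
    where
    open ≤-Reasoning
    all-vertices : Fin k → Bool
    all-vertices _ = true
    all-edges : Fin (e G) → Bool
    all-edges _ = true
    covers-all : Covers all-edges all-vertices
    covers-all v _ with noIsolated v
    ... | i , v∈i = count-pos (λ j → incident j v) ([]=⇒lookup v∈i)

module HarmonicBounds where

  open FloorHarmonic using (floorHarmonic)
  open import Data.Nat as ℕ using (zero; suc)
  import Data.Nat.DivMod as ℕ using (m/n*n≤m)
  import Data.Nat.Properties as ℕ
  open import Data.Integer as ℤ using (+_)
  import Data.Integer.Properties as ℤ
  open import Data.Rational using (_/_; _≤_; _+_; toℚᵘ)
  open import Data.Rational.Properties
    using (toℚᵘ-cancel-≤; toℚᵘ-fromℚᵘ; toℚᵘ-injective; toℚᵘ-homo-+; +-mono-≤; ≤-refl; module ≤-Reasoning)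
  open import Data.Rational.Unnormalised as ℚᵘ using (mkℚᵘ; *≤*; *≡*)
  import Data.Rational.Unnormalised.Properties as ℚᵘ
  open import Relation.Binary.PropositionalEquality

  fraction-≤ : ∀ a b c d → a ℕ.* suc d ℕ.≤ b ℕ.* suc c → (+ a) / suc c ≤ (+ b) / suc d
  fraction-≤ a b c d le =
    toℚᵘ-cancel-≤ (ℚᵘ.≤-respˡ-≃ (ℚᵘ.≃-sym (toℚᵘ-fromℚᵘ (mkℚᵘ (+ a) c)))
                  (ℚᵘ.≤-respʳ-≃ (ℚᵘ.≃-sym (toℚᵘ-fromℚᵘ (mkℚᵘ (+ b) d)))
                  (*≤* (subst₂ ℤ._≤_ (ℤ.pos-* a (suc d)) (ℤ.pos-* b (suc c)) (ℤ.+≤+ le)))))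

  fromℕ-mono-≤ : ∀ {a b} → a ℕ.≤ b → (+ a) / 1 ≤ (+ b) / 1
  fromℕ-mono-≤ {a} {b} a≤b = fraction-≤ a b 0 0 (ℕ.*-monoˡ-≤ 1 a≤b)

  fromℕ-homo-+ : ∀ a b → (+ (a ℕ.+ b)) / 1 ≡ (+ a) / 1 + (+ b) / 1
  fromℕ-homo-+ a b = toℚᵘ-injective (begin
    toℚᵘ ((+ (a ℕ.+ b)) / 1)
      ≈⟨ toℚᵘ-fromℚᵘ (mkℚᵘ (+ (a ℕ.+ b)) 0) ⟩
    mkℚᵘ (+ (a ℕ.+ b)) 0
      ≈⟨ *≡* (cong (ℤ._* + 1) (trans (ℤ.pos-+ a b)
               (sym (cong₂ ℤ._+_ (ℤ.*-identityʳ (+ a)) (ℤ.*-identityʳ (+ b)))))) ⟩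
    mkℚᵘ (+ a) 0 ℚᵘ.+ mkℚᵘ (+ b) 0
      ≈⟨ ℚᵘ.+-cong (toℚᵘ-fromℚᵘ (mkℚᵘ (+ a) 0)) (toℚᵘ-fromℚᵘ (mkℚᵘ (+ b) 0)) ⟨
    toℚᵘ ((+ a) / 1) ℚᵘ.+ toℚᵘ ((+ b) / 1)
      ≈⟨ toℚᵘ-homo-+ ((+ a) / 1) ((+ b) / 1) ⟨
    toℚᵘ ((+ a) / 1 + (+ b) / 1) ∎)
    where open ℚᵘ.≃-Reasoning

  floorHarmonic≤harmonicSum : ∀ n t → (+ floorHarmonic n t) / 1 ≤ harmonicSum n t
  floorHarmonic≤harmonicSum n zero    = ≤-refl
  floorHarmonic≤harmonicSum n (suc t) = begin
    (+ (floorHarmonic n t ℕ.+ n ℕ./ suc t)) / 1       ≡⟨ fromℕ-homo-+ (floorHarmonic n t) (n ℕ./ suc t) ⟩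
    (+ floorHarmonic n t) / 1 + (+ (n ℕ./ suc t)) / 1 ≤⟨ +-mono-≤ (floorHarmonic≤harmonicSum n t) floor-≤ ⟩
    harmonicSum n t + (+ n) / suc t                   ∎
    where
    open ≤-Reasoning
    floor-≤ : (+ (n ℕ./ suc t)) / 1 ≤ (+ n) / suc t
    floor-≤ = fraction-≤ (n ℕ./ suc t) n 0 t (ℕ.≤-trans (ℕ.m/n*n≤m n (suc t)) (ℕ.≤-reflexive (sym (ℕ.*-identityʳ n))))

open import Data.Integer using (+_)
open import Data.Rational using (_≤_; _/_)
open import Data.Rational.Properties using (≤-trans)
open Covering using (vertex-count-≤)
open HarmonicBounds using (fromℕ-mono-≤; floorHarmonic≤harmonicSum)

mainTheorem7 : (n k : ℕ) (G : Hypergraph k) → NoIsolated G → NoPartitionAbove G n →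
                   (+ k) / 1 ≤ bound n
mainTheorem7 n k G noIsolated noPartition =
  ≤-trans (fromℕ-mono-≤ (vertex-count-≤ G noIsolated noPartition)) (floorHarmonic≤harmonicSum n n)
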